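{- For every $k\in\mathbb{N}$, the procedure SP-BFS$(k)$ returns the maximum integer $s$ for which there exists a strong uniquely solvable puzzle $P\subseteq\{1,2,3\}^k$ with $|P|=s$.
   Context: $[k]=\{1,\dots,k\}$. A puzzle of width $k$ is a finite set $P\subseteq\{1,2,3\}^k$ (elements are rows). $P$ is a strong uniquely solvable puzzle (SUSP) if for all $\pi_1,\pi_2,\pi_3\in\mathrm{Sym}(P)$, either $\pi_1=\pi_2=\pi_3$, or there exist $r\in P$ and $c\in[k]$ such that exactly two of $(\pi_1(r))_c=1$, $(\pi_2(r))_c=2$, $(\pi_3(r))_c=3$ hold. For a puzzle $P$ with rows indexed $1,\dots,s$, $G_P$ is the vertex-colored undirected graph with four color classes: row vertices $row_r$ ($r\in[s]$), column vertices $col_c$ ($c\in[k]$), element vertices $e_i$ ($i\in\{1,2,3\}$), and cell vertices $v_{r,c}$; each $v_{r,c}$ is adjacent exactly to $row_r$, $col_c$ and $e_{P(r,c)}$, where $P(r,c)$ is the entry of row $r$ in column $c$. $[G]$ denotes a canonical form of a colored graph: $[G_1]=[G_2]$ iff $G_1\cong G_2$ (color-preserving isomorphism). SP-BFS$(k)$: initialize an empty FIFO queue $Q$, an empty set $I$, and $b=0$; enqueue the empty puzzle. While $Q$ is nonempty: dequeue $P$; for each $r\in\{1,2,3\}^k\setminus P$, let $P'=P\cup\{r\}$; if $P'$ is an SUSP and $[G_{P'}]\notin I$, then enqueue $P'$, add $[G_{P'}]$ to $I$, and set $b=|P'|$. When the queue is empty, return $b$. -}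

module Defs where

open import Level using (0ℓ)
open import Data.Nat using (ℕ; zero; suc; _≤_)
open import Data.Fin using (Fin; zero; suc)
open import Data.Vec using (Vec; lookup)
open import Data.List using (List; []; _∷_; length; _++_)
import Data.List as L
open import Data.List.Membership.Propositional using (_∈_; _∉_)
open import Data.List.Relation.Unary.Unique.Propositional using (Unique)
open import Data.Product using (Σ; ∃; _×_; _,_)
open import Data.Sum using (_⊎_)
open import Data.Empty using (⊥)
open import Relation.Nullary using (¬_)
open import Relation.Binary.PropositionalEquality using (_≡_)
open import Function.Bundles using (_↔_; _⇔_; Inverse)
open import Data.Fin.Permutation using (Permutation′; _⟨$⟩ʳ_)

Sym3 : Set
Sym3 = Fin 3

one two three : Sym3
one   = zero
two   = suc zero
three = suc (suc zero)

Row : ℕ → Set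
Row k = Vec Sym3 k

-- A puzzle is a finite set of rows, represented as a list of rows;
-- it denotes a set exactly when the list has no duplicates (Unique).
-- The rows are indexed by positions 0..s-1 of the list.
Puzzle : ℕ → Set
Puzzle k = List (Row k)

entry : ∀ {k} (P : Puzzle k) → Fin (length P) → Fin k → Sym3
entry P r c = lookup (L.lookup P r) c

ExactlyTwo : Set → Set → Set → Set
ExactlyTwo A B C = (A × B × ¬ C) ⊎ (A × ¬ B × C) ⊎ (¬ A × B × C)

-- Strong uniquely solvable puzzle.  Permutations of the (distinct) rows
-- of P are permutations of the row indices.
SUSP : ∀ {k} → Puzzle k → Set
SUSP {k} P =
  (π₁ π₂ π₃ : Permutation′ (length P)) →
    (∀ r → (π₁ ⟨$⟩ʳ r ≡ π₂ ⟨$⟩ʳ r) × (π₂ ⟨$⟩ʳ r ≡ π₃ ⟨$⟩ʳ r))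
  ⊎ Σ (Fin (length P)) λ r → Σ (Fin k) λ c →
      ExactlyTwo (entry P (π₁ ⟨$⟩ʳ r) c ≡ one)
                 (entry P (π₂ ⟨$⟩ʳ r) c ≡ two)
                 (entry P (π₃ ⟨$⟩ʳ r) c ≡ three)

record ColoredGraph : Set₁ where
  field
    V     : Set
    color : V → Fin 4
    adj   : V → V → Set

open ColoredGraph

_≅_ : ColoredGraph → ColoredGraph → Set
G ≅ H = Σ (V G ↔ V H) λ f →
          (∀ v → color H (Inverse.to f v) ≡ color G v)
        × (∀ u v → adj G u v ⇔ adj H (Inverse.to f u) (Inverse.to f v))

data Vtx (s k : ℕ) : Set where
  rowV  : Fin s → Vtx s k
  colV  : Fin k → Vtx s k
  eltV  : Sym3 → Vtx s k
  cellV : Fin s → Fin k → Vtx s k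

vcolor : ∀ {s k} → Vtx s k → Fin 4
vcolor (rowV _)    = zero
vcolor (colV _)    = suc zero
vcolor (eltV _)    = suc (suc zero)
vcolor (cellV _ _) = suc (suc (suc zero))

CellEdge : ∀ {k} (P : Puzzle k) → Vtx (length P) k → Vtx (length P) k → Set
CellEdge P (cellV r c) (rowV r')  = r ≡ r'
CellEdge P (cellV r c) (colV c')  = c ≡ c'
CellEdge P (cellV r c) (eltV e)   = entry P r c ≡ e
CellEdge P _           _          = ⊥

G : ∀ {k} → Puzzle k → ColoredGraph
G {k} P = record
  { V     = Vtx (length P) k
  ; color = vcolor
  ; adj   = λ u v → CellEdge P u v ⊎ CellEdge P v u
  }

-- Parameters: a canonical-form function `canon` on puzzle graphs
-- (its specification is a hypothesis of the theorem) and the order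
-- `enum` in which the rows r ∈ {1,2,3}^k are tried.

module SPBFS {k : ℕ} {C : Set} (canon : Puzzle k → C) (enum : List (Row k)) where

  -- state: queue Q, set I (as a list), current b
  record State : Set where
    constructor ⟨_,_,_⟩
    field
      queue : List (Puzzle k)
      seen  : List C
      best  : ℕ

  -- processing the inner loop "for each r ∈ {1,2,3}^k \ P" for a dequeued P
  data Inner (P : Puzzle k) : List (Row k) → State → State → Set where
    done   : ∀ {st} → Inner P [] st st
    member : ∀ {r rs st st'} → r ∈ P → Inner P rs st st' → Inner P (r ∷ rs) st st'
    accept : ∀ {r rs Q I b st'} → r ∉ P →
             SUSP (r ∷ P) → canon (r ∷ P) ∉ I →
             Inner P rs ⟨ Q ++ ((r ∷ P) ∷ []) , canon (r ∷ P) ∷ I , length (r ∷ P) ⟩ st' →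
             Inner P (r ∷ rs) ⟨ Q , I , b ⟩ st'
    reject : ∀ {r rs Q I b st'} → r ∉ P →
             ¬ (SUSP (r ∷ P) × canon (r ∷ P) ∉ I) →
             Inner P rs ⟨ Q , I , b ⟩ st' →
             Inner P (r ∷ rs) ⟨ Q , I , b ⟩ st'

  -- the outer "while Q nonempty" loop; Run st res: started in st, the loop
  -- terminates and returns res
  data Run : State → ℕ → Set where
    stop : ∀ {I b} → Run ⟨ [] , I , b ⟩ b
    step : ∀ {P Q I b st' res} →
           Inner P enum ⟨ Q , I , b ⟩ st' → Run st' res →
           Run ⟨ P ∷ Q , I , b ⟩ res

  Returns : ℕ → Set
  Returns b = Run ⟨ [] ∷ [] , [] , 0 ⟩ b

IsMaxSUSPSize : ℕ → ℕ → Set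
IsMaxSUSPSize k s =
    (Σ (Puzzle k) λ P → Unique P × SUSP P × length P ≡ s)
  × (∀ (P : Puzzle k) → Unique P → SUSP P → length P ≤ s)

{-# OPTIONS --safe #-}
module Submission where

-- Permuting rows, columns and symbols of a puzzle is the same as an isomorphism of
-- its graph, so the set I holds exactly one canonical form per equivalence class of
-- the puzzles found so far. Being an SUSP is invariant under this equivalence and
-- survives deleting a row. Since the queue is processed in order of size, every
-- dequeued puzzle ends up closed: each SUSP extension of it by one row is equivalent
-- to a found puzzle. Hence, by induction on its rows, every SUSP is equivalent to a
-- found puzzle, and the size b of the last accepted puzzle is the largest SUSP size.
-- The loop terminates because a dequeued puzzle of n distinct rows is replaced by at
-- most E = |enum| puzzles of n + 1 rows, so the queue weight Σ (E + 1) ^ (E ∸ |P|)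
-- strictly decreases. The branch conditions of the loop are decidable because SUSP and
-- equivalence only quantify over permutations of finite sets, which can be enumerated.

open import Defs
open ColoredGraph using (adj)
open import Data.Nat using (ℕ; zero; suc; _≤_; _<_; z≤n; s≤s; _+_; _*_; _∸_; _^_)
open import Data.Nat.Properties
  using (≤-refl; ≤-trans; ≤-<-trans; n≤1+n; n<1+n; m≤n⇒m≤1+n; *-monoˡ-≤; *-monoˡ-<; +-monoʳ-<; +-identityʳ; +-assoc; +-comm; +-∸-assoc; m^n>0; m^n≢0; module ≤-Reasoning)
open import Data.Nat.Induction using (<-wellFounded)
open import Data.Nat.ListAction using (sum)
open import Data.Nat.ListAction.Properties using (sum-++)
open import Data.Fin using (Fin; zero; suc; _≟_)
open import Data.Fin.Properties using (suc-injective; injective⇒≤)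
import Data.Fin.Properties as Fin
open import Data.Fin.Permutation
  using (Permutation; Permutation′; _⟨$⟩ʳ_; _⟨$⟩ˡ_; permutation; inverseˡ; inverseʳ; _∘ₚ_; flip; lift₀; ↔⇒≡)
  renaming (_≈_ to _≈ₚ_)
import Data.Fin.Permutation as Perm
open import Data.List using (List; []; _∷_; length; _++_; _∷ʳ_; map)
import Data.List as L
open import Data.List.Properties using (map-++)
open import Data.List.Membership.Propositional using (_∈_; _∉_; find)
open import Data.List.Membership.Propositional.Properties using (∈-lookup; ∈-++⁺ˡ; ∈-++⁺ʳ)
open import Data.List.Relation.Binary.Subset.Propositional using (_⊆_)
open import Data.List.Relation.Unary.All as All using (All; []; _∷_)
open import Data.List.Relation.Unary.All.Properties using (¬Any⇒All¬; All¬⇒¬Any; ++⁺)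
open import Data.List.Relation.Unary.AllPairs as AllPairs using (AllPairs; []; _∷_)
import Data.List.Relation.Unary.AllPairs.Properties as AllPairs
open import Data.List.Relation.Unary.Any as Any using (Any; here; there)
open import Data.List.Relation.Unary.Any.Properties using (lookup-index; map⁺; map⁻; ++⁺ˡ; ++⁺ʳ)
open import Data.List.Relation.Unary.Unique.Propositional using (Unique)
open import Data.Vec using (Vec; lookup; tabulate)
open import Data.Vec.Properties using (tabulate∘lookup; tabulate-cong; lookup∘tabulate; ≡-dec)
open import Data.Vec.Functional using (head; tail) renaming ([] to []ᵛ; _∷_ to _∷ᵛ_)
open import Data.Vec.Functional.Properties using (∷-cong)
open import Data.Product using (Σ; ∃; ∃₂; _×_; _,_; proj₁; proj₂)
open import Data.Sum using (_⊎_; inj₁; inj₂; [_,_])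
import Data.Sum as Sum
open import Data.Sum.Function.Propositional using (_⊎-⇔_)
open import Data.Empty using (⊥-elim)
open import Function using (_∘_; _$_; id)
open import Function.Bundles using (_↔_; _⇔_; Inverse; Equivalence; Injection; mk⇔; mk↔ₛ′)
open import Function.Properties.Inverse using (↔⇒↣)
open import Induction.WellFounded using (Acc; acc)
open import Relation.Binary.Definitions using (_Respects_)
open import Relation.Binary.PropositionalEquality
  using (_≡_; _≢_; refl; sym; trans; cong; cong₂; subst; subst₂; _≗_; module ≡-Reasoning)
open import Relation.Nullary using (¬_; Dec; yes; no; ¬?; contradiction)
open import Relation.Nullary.Decidable using (_×-dec_; _⊎-dec_; map′; decidable-stable)
open import Relation.Unary using (Decidable)

private variable
  k : ℕ

-- Deciding quantifiers over functions and permutations of finite sets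

any-function? : ∀ n {m} {P : (Fin n → Fin m) → Set} →
                P Respects _≗_ → Decidable P → Dec (∃ P)
any-function? zero P-resp P? = map′ (λ p → _ , p) (λ (f , p) → P-resp (λ ()) p) (P? (λ ()))
any-function? (suc n) {P = P} P-resp P? =
  map′ (λ (x , f , p) → x ∷ᵛ f , p) (λ (f , p) → head f , tail f , P-resp head∷tail p)
       (Fin.any? λ x → any-function? n (P-resp ∘ ∷-cong refl) (P? ∘ (x ∷ᵛ_)))
  where
  head∷tail : ∀ {f : Fin (suc n) → _} → f ≗ head f ∷ᵛ tail f
  head∷tail = ∷-cong refl (λ _ → refl)

module _ {n m : ℕ} {P : Permutation n m → Set} (P-resp : P Respects _≈ₚ_) (P? : Decidable P) where

  private
    Inverses : (Fin n → Fin m) → (Fin m → Fin n) → Set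
    Inverses f g = (∀ y → f (g y) ≡ y) × (∀ x → g (f x) ≡ x)

    Witness : (Fin n → Fin m) → (Fin m → Fin n) → Set
    Witness f g = Σ (Inverses f g) λ (l , r) → P (permutation f g l r)

    witness? : ∀ f → Decidable (Witness f)
    witness? f g with Fin.all? (λ y → f (g y) ≟ y) ×-dec Fin.all? (λ x → g (f x) ≟ x)
    ... | no ¬inv = no (¬inv ∘ proj₁)
    ... | yes (l , r) = map′ ((l , r) ,_) (P-resp (λ _ → refl) ∘ proj₂) (P? (permutation f g l r))

    witness-resp : ∀ f → Witness f Respects _≗_
    witness-resp f g≗h ((l , r) , p) =
      ((λ y → trans (cong f (sym (g≗h y))) (l y)) , (λ x → trans (sym (g≗h (f x))) (r x))) ,
      P-resp (λ _ → refl) p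

    inverse-resp : (λ f → ∃ (Witness f)) Respects _≗_
    inverse-resp f≗h (g , (l , r) , p) =
      g , ((λ y → trans (sym (f≗h (g y))) (l y)) , (λ x → trans (cong g (sym (f≗h x))) (r x))) ,
      P-resp f≗h p

  any-permutation? : Dec (∃ P)
  any-permutation? =
    map′ (λ (_ , _ , _ , p) → _ , p)
         (λ (π , p) → (π ⟨$⟩ʳ_) , (π ⟨$⟩ˡ_) , ((λ _ → inverseʳ π) , (λ _ → inverseˡ π)) , P-resp (λ _ → refl) p)
         (any-function? n inverse-resp λ f → any-function? m (witness-resp f) (witness? f))

all-permutations? : ∀ {n m} {P : Permutation n m → Set} → P Respects _≈ₚ_ → Decidable P → Dec (∀ π → P π)
all-permutations? {P = P} P-resp P? =
  map′ (λ ¬counterexample π → decidable-stable (P? π) (¬counterexample ∘ (π ,_)))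
       (λ all (π , ¬p) → ¬p (all π))
       (¬? (any-permutation? (λ π≈ρ ¬p → ¬p ∘ P-resp (sym ∘ π≈ρ)) (¬? ∘ P?)))

⟨$⟩ʳ-injective : ∀ {m n} (π : Permutation m n) {i j} → π ⟨$⟩ʳ i ≡ π ⟨$⟩ʳ j → i ≡ j
⟨$⟩ʳ-injective π = Injection.injective (↔⇒↣ π)

⟨$⟩ˡ-injective : ∀ {m n} (π : Permutation m n) {i j} → π ⟨$⟩ˡ i ≡ π ⟨$⟩ˡ j → i ≡ j
⟨$⟩ˡ-injective π = ⟨$⟩ʳ-injective (flip π)

module Restriction {V W A B : Set} (f : V ↔ W) (inA : A → V) (inB : B → W)
  (inA-injective : ∀ {a a′} → inA a ≡ inA a′ → a ≡ a′) (inB-injective : ∀ {b b′} → inB b ≡ inB b′ → b ≡ b′)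
  (to-in : ∀ a → ∃ λ b → Inverse.to f (inA a) ≡ inB b) (from-in : ∀ b → ∃ λ a → Inverse.from f (inB b) ≡ inA a)
  where
  open Inverse f using (to; from; strictlyInverseˡ; strictlyInverseʳ)
  open ≡-Reasoning

  restriction : A ↔ B
  restriction = mk↔ₛ′ (proj₁ ∘ to-in) (proj₁ ∘ from-in) to∘from from∘to
    where
    to∘from : ∀ b → proj₁ (to-in (proj₁ (from-in b))) ≡ b
    to∘from b = inB-injective $ begin
      inB _                       ≡⟨ proj₂ (to-in _) ⟨
      to (inA (proj₁ (from-in b))) ≡⟨ cong to (proj₂ (from-in b)) ⟨
      to (from (inB b))            ≡⟨ strictlyInverseˡ (inB b) ⟩
      inB b                        ∎
    from∘to : ∀ a → proj₁ (from-in (proj₁ (to-in a))) ≡ a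
    from∘to a = inA-injective $ begin
      inA _                       ≡⟨ proj₂ (from-in _) ⟨
      from (inB (proj₁ (to-in a))) ≡⟨ cong from (proj₂ (to-in a)) ⟨
      from (to (inA a))            ≡⟨ strictlyInverseʳ (inA a) ⟩
      inA a                        ∎

  to-restriction : ∀ a → to (inA a) ≡ inB (Inverse.to restriction a)
  to-restriction = proj₂ ∘ to-in

Constant : ∀ {n} {A : Set} → (Fin n → A) → Set
Constant x = ∀ i j → x i ≡ x j

Constant-∘ : ∀ {n} {A B : Set} {f : A → B} {x : Fin n → A} →
             (∀ {a b} → f a ≡ f b → a ≡ b) → Constant (f ∘ x) → Constant x
Constant-∘ f-injective const i j = f-injective (const i j)

Constant-reindex : ∀ {n} {A : Set} {x : Fin n → A} (σ : Permutation′ n) →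
                   Constant (x ∘ (σ ⟨$⟩ʳ_)) → Constant x
Constant-reindex {x = x} σ const i j =
  trans (cong x (sym (inverseʳ σ))) (trans (const (σ ⟨$⟩ˡ i) (σ ⟨$⟩ˡ j)) (cong x (inverseʳ σ)))

ExactlyOneFails : ∀ {n} → (Fin n → Set) → Set
ExactlyOneFails {n} B = Σ (Fin n) λ j → ¬ B j × (∀ i → i ≢ j → B i)

ExactlyOneFails-reindex : ∀ {n} {A B : Fin n → Set} (σ : Permutation′ n) →
                          (∀ j → B j → A (σ ⟨$⟩ʳ j)) → (∀ j → A (σ ⟨$⟩ʳ j) → B j) →
                          ExactlyOneFails B → ExactlyOneFails A
ExactlyOneFails-reindex {A = A} σ B⇒A A⇒B (j , ¬Bj , B-others) =
  σ ⟨$⟩ʳ j , ¬Bj ∘ A⇒B j , λ i i≢σj →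
    subst A (inverseʳ σ) (B⇒A _ (B-others _ λ σ⁻¹i≡j → i≢σj (trans (sym (inverseʳ σ)) (cong (σ ⟨$⟩ʳ_) σ⁻¹i≡j))))

module _ {A : Set} {x : Fin 3 → A} where

  chain⇒Constant : x zero ≡ x (suc zero) → x (suc zero) ≡ x (suc (suc zero)) → Constant x
  chain⇒Constant x₀≡x₁ x₁≡x₂ i j = trans (≡x₀ i) (sym (≡x₀ j))
    where
    ≡x₀ : ∀ i → x i ≡ x zero
    ≡x₀ zero             = refl
    ≡x₀ (suc zero)       = sym x₀≡x₁
    ≡x₀ (suc (suc zero)) = sym (trans x₀≡x₁ x₁≡x₂)

module _ (B : Fin 3 → Set) where

  exactlyTwo⇒exactlyOneFails : ExactlyTwo (B zero) (B (suc zero)) (B (suc (suc zero))) → ExactlyOneFails B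
  exactlyTwo⇒exactlyOneFails (inj₁ (b₀ , b₁ , ¬b₂)) = _ , ¬b₂ , λ
    { zero _ → b₀ ; (suc zero) _ → b₁ ; (suc (suc zero)) i≢i → contradiction refl i≢i }
  exactlyTwo⇒exactlyOneFails (inj₂ (inj₁ (b₀ , ¬b₁ , b₂))) = _ , ¬b₁ , λ
    { zero _ → b₀ ; (suc zero) i≢i → contradiction refl i≢i ; (suc (suc zero)) _ → b₂ }
  exactlyTwo⇒exactlyOneFails (inj₂ (inj₂ (¬b₀ , b₁ , b₂))) = _ , ¬b₀ , λ
    { zero i≢i → contradiction refl i≢i ; (suc zero) _ → b₁ ; (suc (suc zero)) _ → b₂ }

  exactlyOneFails⇒exactlyTwo : ExactlyOneFails B → ExactlyTwo (B zero) (B (suc zero)) (B (suc (suc zero)))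
  exactlyOneFails⇒exactlyTwo (zero , ¬b , b)             = inj₂ (inj₂ (¬b , b _ (λ ()) , b _ (λ ())))
  exactlyOneFails⇒exactlyTwo (suc zero , ¬b , b)         = inj₂ (inj₁ (b _ (λ ()) , ¬b , b _ (λ ())))
  exactlyOneFails⇒exactlyTwo (suc (suc zero) , ¬b , b)   = inj₁ (b _ (λ ()) , b _ (λ ()) , ¬b)

Unique-lookup-injective : ∀ {A : Set} {xs : List A} → Unique xs → ∀ {i j} → L.lookup xs i ≡ L.lookup xs j → i ≡ j
Unique-lookup-injective (x∉ ∷ u) {zero}  {zero}  _  = refl
Unique-lookup-injective (x∉ ∷ u) {zero}  {suc j} eq = contradiction eq (All.lookup x∉ (∈-lookup j))
Unique-lookup-injective (x∉ ∷ u) {suc i} {zero}  eq = contradiction (sym eq) (All.lookup x∉ (∈-lookup i))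
Unique-lookup-injective (x∉ ∷ u) {suc i} {suc j} eq = cong suc (Unique-lookup-injective u eq)

lookup-ext : ∀ {A : Set} {n} (u v : Vec A n) → (∀ i → lookup u i ≡ lookup v i) → u ≡ v
lookup-ext u v u≗v = trans (sym (tabulate∘lookup u)) (trans (tabulate-cong u≗v) (tabulate∘lookup v))

Unique-∷ : ∀ {A : Set} {x} {xs : List A} → x ∉ xs → Unique xs → Unique (x ∷ xs)
Unique-∷ x∉xs u = ¬Any⇒All¬ _ x∉xs ∷ u

Unique-length-≤ : ∀ {A : Set} {xs ys : List A} → Unique xs → xs ⊆ ys → length xs ≤ length ys
Unique-length-≤ {xs = xs} {ys} u xs⊆ys = injective⇒≤ λ {i} {j} eq →
  Unique-lookup-injective u (trans (lookup-index (xs⊆ys (∈-lookup i)))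
    (trans (cong (L.lookup ys) eq) (sym (lookup-index (xs⊆ys (∈-lookup j))))))

-- Strong uniquely solvable puzzles

_∈ᴿ?_ : (r : Row k) (P : Puzzle k) → Dec (r ∈ P)
r ∈ᴿ? P = Any.any? (≡-dec _≟_ r) P

exactlyTwo? : ∀ {A B C : Set} → Dec A → Dec B → Dec C → Dec (ExactlyTwo A B C)
exactlyTwo? a b c = (a ×-dec b ×-dec ¬? c) ⊎-dec (a ×-dec ¬? b ×-dec c) ⊎-dec (¬? a ×-dec b ×-dec c)

SUSPCondition : (P : Puzzle k) (f g h : Fin (length P) → Fin (length P)) → Set
SUSPCondition {k} P f g h =
    (∀ r → (f r ≡ g r) × (g r ≡ h r))
  ⊎ Σ (Fin (length P)) λ r → Σ (Fin k) λ c →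
      ExactlyTwo (entry P (f r) c ≡ one) (entry P (g r) c ≡ two) (entry P (h r) c ≡ three)

SUSPCondition-resp : ∀ (P : Puzzle k) {f f′ g g′ h h′} → f ≗ f′ → g ≗ g′ → h ≗ h′ →
                     SUSPCondition P f g h → SUSPCondition P f′ g′ h′
SUSPCondition-resp P f≗ g≗ h≗ (inj₁ equal) =
  inj₁ λ r → trans (sym (f≗ r)) (trans (proj₁ (equal r)) (g≗ r)) ,
             trans (sym (g≗ r)) (trans (proj₂ (equal r)) (h≗ r))
SUSPCondition-resp P f≗ g≗ h≗ (inj₂ (r , c , exactlyTwo)) = inj₂ (r , c , moveRows (f≗ r) (g≗ r) (h≗ r) exactlyTwo)
  where
  moveRows : ∀ {a a′ b b′ d d′} → a ≡ a′ → b ≡ b′ → d ≡ d′ →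
             ExactlyTwo (entry P a c ≡ one) (entry P b c ≡ two) (entry P d c ≡ three) →
             ExactlyTwo (entry P a′ c ≡ one) (entry P b′ c ≡ two) (entry P d′ c ≡ three)
  moveRows refl refl refl exactlyTwo = exactlyTwo

SUSPCondition? : ∀ (P : Puzzle k) f g h → Dec (SUSPCondition P f g h)
SUSPCondition? P f g h =
  Fin.all? (λ r → (f r ≟ g r) ×-dec (g r ≟ h r)) ⊎-dec
  Fin.any? (λ r → Fin.any? λ c → exactlyTwo? (entry P (f r) c ≟ one) (entry P (g r) c ≟ two) (entry P (h r) c ≟ three))

SUSP? : (P : Puzzle k) → Dec (SUSP P)
SUSP? P =
  all-permutations? (λ π≈ susp π₂ π₃ → SUSPCondition-resp P π≈ (λ _ → refl) (λ _ → refl) (susp π₂ π₃)) λ π₁ →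
  all-permutations? (λ π≈ susp π₃ → SUSPCondition-resp P (λ _ → refl) π≈ (λ _ → refl) (susp π₃)) λ π₂ →
  all-permutations? (SUSPCondition-resp P (λ _ → refl) (λ _ → refl)) λ π₃ →
  SUSPCondition? P _ _ _

-- The SUSP condition with the three permutations indexed by the symbol they test,
-- so that a permutation of the symbols acts on it by reindexing.
SUSP₃ : Puzzle k → Set
SUSP₃ {k} P = ∀ (π : Fin 3 → Permutation′ (length P)) →
    (∀ r → Constant λ i → π i ⟨$⟩ʳ r)
  ⊎ Σ (Fin (length P)) λ r → Σ (Fin k) λ c → ExactlyOneFails λ i → entry P (π i ⟨$⟩ʳ r) c ≡ i

SUSP⇒SUSP₃ : {P : Puzzle k} → SUSP P → SUSP₃ P
SUSP⇒SUSP₃ susp π with susp (π zero) (π (suc zero)) (π (suc (suc zero)))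
... | inj₁ equal              = inj₁ λ r → chain⇒Constant (proj₁ (equal r)) (proj₂ (equal r))
... | inj₂ (r , c , exactlyTwo) = inj₂ (r , c , exactlyTwo⇒exactlyOneFails _ exactlyTwo)

SUSP₃⇒SUSP : {P : Puzzle k} → SUSP₃ P → SUSP P
SUSP₃⇒SUSP susp π₁ π₂ π₃ with susp (π₁ ∷ᵛ π₂ ∷ᵛ π₃ ∷ᵛ []ᵛ)
... | inj₁ const            = inj₁ λ r → const r zero (suc zero) , const r (suc zero) (suc (suc zero))
... | inj₂ (r , c , fails)  = inj₂ (r , c , exactlyOneFails⇒exactlyTwo _ fails)

SUSP-[] : SUSP {k} []
SUSP-[] _ _ _ = inj₁ λ ()

sameSymbol-¬exactlyTwo : ∀ (s : Sym3) → ¬ ExactlyTwo (s ≡ one) (s ≡ two) (s ≡ three)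
sameSymbol-¬exactlyTwo _ (inj₁ (refl , () , _))
sameSymbol-¬exactlyTwo _ (inj₂ (inj₁ (refl , _ , ())))
sameSymbol-¬exactlyTwo _ (inj₂ (inj₂ (_ , refl , ())))

SUSP-tail : ∀ (r : Row k) (P : Puzzle k) → SUSP (r ∷ P) → SUSP P
SUSP-tail r P susp π₁ π₂ π₃ with susp (lift₀ π₁) (lift₀ π₂) (lift₀ π₃)
... | inj₁ equal = inj₁ λ q → suc-injective (proj₁ (equal (suc q))) , suc-injective (proj₂ (equal (suc q)))
... | inj₂ (suc q , c , exactlyTwo) = inj₂ (q , c , exactlyTwo)
... | inj₂ (zero , c , exactlyTwo) = ⊥-elim (sameSymbol-¬exactlyTwo _ exactlyTwo)

-- Equivalence of puzzles

record _∼_ (P Q : Puzzle k) : Set where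
  constructor mk∼
  field
    rows    : Permutation (length P) (length Q)
    columns : Permutation′ k
    symbols : Permutation′ 3
    relabel : ∀ r c → entry Q (rows ⟨$⟩ʳ r) (columns ⟨$⟩ʳ c) ≡ symbols ⟨$⟩ʳ entry P r c

  relabelˡ : ∀ q c → entry Q q (columns ⟨$⟩ʳ c) ≡ symbols ⟨$⟩ʳ entry P (rows ⟨$⟩ˡ q) c
  relabelˡ q c = trans (cong (λ q′ → entry Q q′ _) (sym (inverseʳ rows))) (relabel _ c)

∼-refl : {P : Puzzle k} → P ∼ P
∼-refl = mk∼ Perm.id Perm.id Perm.id λ _ _ → refl

∼-trans : {P Q R : Puzzle k} → P ∼ Q → Q ∼ R → P ∼ R
∼-trans (mk∼ ρ γ σ relabel) (mk∼ ρ′ γ′ σ′ relabel′) =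
  mk∼ (ρ ∘ₚ ρ′) (γ ∘ₚ γ′) (σ ∘ₚ σ′) λ r c → trans (relabel′ _ _) (cong (σ′ ⟨$⟩ʳ_) (relabel r c))

_∼?_ : (P Q : Puzzle k) → Dec (P ∼ Q)
P ∼? Q =
  map′ (λ (ρ , γ , σ , relabel) → mk∼ ρ γ σ relabel) (λ (mk∼ ρ γ σ relabel) → ρ , γ , σ , relabel) $
  any-permutation? (λ ρ≈ (γ , σ , relabel) → γ , σ , λ r c → trans (cong (λ q → entry Q q _) (sym (ρ≈ r))) (relabel r c)) λ ρ →
  any-permutation? (λ γ≈ (σ , relabel) → σ , λ r c → trans (cong (entry Q _) (sym (γ≈ c))) (relabel r c)) λ γ →
  any-permutation? (λ σ≈ relabel r c → trans (relabel r c) (σ≈ _)) λ σ →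
  Fin.all? λ r → Fin.all? λ c → entry Q (ρ ⟨$⟩ʳ r) (γ ⟨$⟩ʳ c) ≟ σ ⟨$⟩ʳ entry P r c

SUSP₃-resp-∼ : {P Q : Puzzle k} → P ∼ Q → SUSP₃ P → SUSP₃ Q
SUSP₃-resp-∼ {P = P} {Q} e@(mk∼ ρ γ σ _) susp π with susp (λ j → ρ ∘ₚ π (σ ⟨$⟩ʳ j) ∘ₚ flip ρ)
... | inj₁ const = inj₁ λ q →
  Constant-reindex σ $ subst (λ q′ → Constant λ j → π (σ ⟨$⟩ʳ j) ⟨$⟩ʳ q′) (inverseʳ ρ) $
  Constant-∘ (⟨$⟩ˡ-injective ρ) (const (ρ ⟨$⟩ˡ q))
... | inj₂ (p , c , fails) = inj₂ (ρ ⟨$⟩ʳ p , γ ⟨$⟩ʳ c , ExactlyOneFails-reindex σ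
  (λ j hit → trans (relabelˡ _ c) (cong (σ ⟨$⟩ʳ_) hit))
  (λ j hit → ⟨$⟩ʳ-injective σ (trans (sym (relabelˡ _ c)) hit))
  fails)
  where open _∼_ e

SUSP-resp-∼ : {P Q : Puzzle k} → P ∼ Q → SUSP P → SUSP Q
SUSP-resp-∼ {P = P} {Q} e = SUSP₃⇒SUSP {P = Q} ∘ SUSP₃-resp-∼ e ∘ SUSP⇒SUSP₃ {P = P}

module _ {P Q : Puzzle k} (e : P ∼ Q) where
  open _∼_ e

  relabelRow : Row k → Row k
  relabelRow r = tabulate λ d → symbols ⟨$⟩ʳ lookup r (columns ⟨$⟩ˡ d)

  lookup-relabelRow : ∀ r c → lookup (relabelRow r) (columns ⟨$⟩ʳ c) ≡ symbols ⟨$⟩ʳ lookup r c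
  lookup-relabelRow r c =
    trans (lookup∘tabulate _ (columns ⟨$⟩ʳ c)) (cong (λ c′ → symbols ⟨$⟩ʳ lookup r c′) (inverseˡ columns))

  ∼-∷ : ∀ r → (r ∷ P) ∼ (relabelRow r ∷ Q)
  ∼-∷ r = mk∼ (lift₀ rows) columns symbols λ where
    zero    c → lookup-relabelRow r c
    (suc i) c → relabel i c

  relabelRow-∉ : ∀ {r} → r ∉ P → relabelRow r ∉ Q
  relabelRow-∉ {r} r∉P r′∈Q = r∉P (subst (_∈ P) (lookup-ext _ _ sameEntries) (∈-lookup (rows ⟨$⟩ˡ j)))
    where
    open ≡-Reasoning
    j = Any.index r′∈Q
    sameEntries : ∀ c → entry P (rows ⟨$⟩ˡ j) c ≡ lookup r c
    sameEntries c = ⟨$⟩ʳ-injective symbols $ begin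
      symbols ⟨$⟩ʳ entry P (rows ⟨$⟩ˡ j) c   ≡⟨ relabelˡ j c ⟨
      entry Q j (columns ⟨$⟩ʳ c)            ≡⟨ cong (λ row → lookup row (columns ⟨$⟩ʳ c)) (lookup-index r′∈Q) ⟨
      lookup (relabelRow r) (columns ⟨$⟩ʳ c) ≡⟨ lookup-relabelRow r c ⟩
      symbols ⟨$⟩ʳ lookup r c                ∎

-- Equivalence is isomorphism of puzzle graphs

mapVtx : ∀ {s s′} → Permutation s s′ → Permutation′ k → Permutation′ 3 → Vtx s k → Vtx s′ k
mapVtx ρ γ σ (rowV r)    = rowV (ρ ⟨$⟩ʳ r)
mapVtx ρ γ σ (colV c)    = colV (γ ⟨$⟩ʳ c)
mapVtx ρ γ σ (eltV x)    = eltV (σ ⟨$⟩ʳ x)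
mapVtx ρ γ σ (cellV r c) = cellV (ρ ⟨$⟩ʳ r) (γ ⟨$⟩ʳ c)

mapVtx-flip : ∀ {s s′} (ρ : Permutation s s′) (γ : Permutation′ k) (σ : Permutation′ 3) v →
              mapVtx (flip ρ) (flip γ) (flip σ) (mapVtx ρ γ σ v) ≡ v
mapVtx-flip ρ γ σ (rowV r)    = cong rowV (inverseˡ ρ)
mapVtx-flip ρ γ σ (colV c)    = cong colV (inverseˡ γ)
mapVtx-flip ρ γ σ (eltV x)    = cong eltV (inverseˡ σ)
mapVtx-flip ρ γ σ (cellV r c) = cong₂ cellV (inverseˡ ρ) (inverseˡ γ)

vcolor-mapVtx : ∀ {s s′} (ρ : Permutation s s′) (γ : Permutation′ k) (σ : Permutation′ 3) v →
                vcolor (mapVtx ρ γ σ v) ≡ vcolor v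
vcolor-mapVtx ρ γ σ (rowV _)    = refl
vcolor-mapVtx ρ γ σ (colV _)    = refl
vcolor-mapVtx ρ γ σ (eltV _)    = refl
vcolor-mapVtx ρ γ σ (cellV _ _) = refl

module _ {P Q : Puzzle k} (e : P ∼ Q) where
  open _∼_ e

  private
    f : Vtx (length P) k → Vtx (length Q) k
    f = mapVtx rows columns symbols

  cellEdge-mapVtx : ∀ u v → CellEdge P u v ⇔ CellEdge Q (f u) (f v)
  cellEdge-mapVtx (cellV r c) (rowV r′)  = mk⇔ (cong (rows ⟨$⟩ʳ_)) (⟨$⟩ʳ-injective rows)
  cellEdge-mapVtx (cellV r c) (colV c′)  = mk⇔ (cong (columns ⟨$⟩ʳ_)) (⟨$⟩ʳ-injective columns)
  cellEdge-mapVtx (cellV r c) (eltV x)   =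
    mk⇔ (λ eq → trans (relabel r c) (cong (symbols ⟨$⟩ʳ_) eq)) (λ eq → ⟨$⟩ʳ-injective symbols (trans (sym (relabel r c)) eq))
  cellEdge-mapVtx (cellV _ _) (cellV _ _) = mk⇔ id id
  cellEdge-mapVtx (rowV _) _ = mk⇔ id id
  cellEdge-mapVtx (colV _) _ = mk⇔ id id
  cellEdge-mapVtx (eltV _) _ = mk⇔ id id

  ∼⇒≅ : G P ≅ G Q
  ∼⇒≅ = mk↔ₛ′ f (mapVtx (flip rows) (flip columns) (flip symbols))
               (mapVtx-flip (flip rows) (flip columns) (flip symbols)) (mapVtx-flip rows columns symbols)
      , vcolor-mapVtx rows columns symbols
      , λ u v → cellEdge-mapVtx u v ⊎-⇔ cellEdge-mapVtx v u

module _ {s : ℕ} where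

  rowV-injective : ∀ {r r′ : Fin s} → rowV {k = k} r ≡ rowV r′ → r ≡ r′
  rowV-injective refl = refl

  colV-injective : ∀ {c c′ : Fin k} → colV {s = s} c ≡ colV c′ → c ≡ c′
  colV-injective refl = refl

  eltV-injective : ∀ {x y : Sym3} → eltV {s = s} {k = k} x ≡ eltV y → x ≡ y
  eltV-injective refl = refl

  rowV-of-vcolor : (v : Vtx s k) → vcolor v ≡ zero → ∃ λ r → v ≡ rowV r
  rowV-of-vcolor (rowV r) _ = r , refl

  colV-of-vcolor : (v : Vtx s k) → vcolor v ≡ suc zero → ∃ λ c → v ≡ colV c
  colV-of-vcolor (colV c) _ = c , refl

  eltV-of-vcolor : (v : Vtx s k) → vcolor v ≡ suc (suc zero) → ∃ λ x → v ≡ eltV x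
  eltV-of-vcolor (eltV x) _ = x , refl

  cellV-of-vcolor : (v : Vtx s k) → vcolor v ≡ suc (suc (suc zero)) → ∃₂ λ r c → v ≡ cellV r c
  cellV-of-vcolor (cellV r c) _ = r , c , refl

fromCell : ∀ {P : Puzzle k} {r c} v → adj (G P) (cellV r c) v → CellEdge P (cellV r c) v
fromCell _           (inj₁ edge) = edge
fromCell (rowV _)    (inj₂ ())
fromCell (colV _)    (inj₂ ())
fromCell (eltV _)    (inj₂ ())
fromCell (cellV _ _) (inj₂ ())

module _ {P Q : Puzzle k} (iso : G P ≅ G Q) where
  private
    open Inverse (proj₁ iso) using (to; from; strictlyInverseˡ)

    preserves : ∀ v → vcolor (to v) ≡ vcolor v
    preserves = proj₁ (proj₂ iso)

    preserves⁻¹ : ∀ w → vcolor (from w) ≡ vcolor w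
    preserves⁻¹ w = trans (sym (preserves (from w))) (cong vcolor (strictlyInverseˡ w))

    edgeTo : ∀ {u v} → adj (G P) u v → adj (G Q) (to u) (to v)
    edgeTo {u} {v} = Equivalence.to (proj₂ (proj₂ iso) u v)

    module Rows = Restriction (proj₁ iso) rowV rowV rowV-injective rowV-injective
      (λ r → rowV-of-vcolor _ (preserves (rowV r))) (λ r → rowV-of-vcolor _ (preserves⁻¹ (rowV r)))
    module Cols = Restriction (proj₁ iso) colV colV colV-injective colV-injective
      (λ c → colV-of-vcolor _ (preserves (colV c))) (λ c → colV-of-vcolor _ (preserves⁻¹ (colV c)))
    module Syms = Restriction (proj₁ iso) eltV eltV eltV-injective eltV-injective
      (λ x → eltV-of-vcolor _ (preserves (eltV x))) (λ x → eltV-of-vcolor _ (preserves⁻¹ (eltV x)))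

    ρ : Permutation (length P) (length Q)
    ρ = Rows.restriction

    γ : Permutation′ k
    γ = Cols.restriction

    σ : Permutation′ 3
    σ = Syms.restriction

    relabel : ∀ r c → entry Q (ρ ⟨$⟩ʳ r) (γ ⟨$⟩ʳ c) ≡ σ ⟨$⟩ʳ entry P r c
    relabel r c with cellV-of-vcolor (to (cellV r c)) (preserves (cellV r c))
    ... | a , b , to≡cell =
      subst₂ (λ a b → entry Q a b ≡ _)
        (neighbour refl (Rows.to-restriction r)) (neighbour refl (Cols.to-restriction c))
        (neighbour refl (Syms.to-restriction (entry P r c)))
      where
      neighbour : ∀ {v w} → CellEdge P (cellV r c) v → to v ≡ w → CellEdge Q (cellV a b) w
      neighbour edge to≡w = fromCell _ (subst₂ (adj (G Q)) to≡cell to≡w (edgeTo (inj₁ edge)))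

  ≅⇒∼ : P ∼ Q
  ≅⇒∼ = mk∼ ρ γ σ relabel

-- SP-BFS

module BFS (k : ℕ) {C : Set} (canon : Puzzle k → C)
  (canon-spec : ∀ (P Q : Puzzle k) → (canon P ≡ canon Q) ⇔ (G P ≅ G Q))
  (enum : List (Row k)) (enum-complete : ∀ (r : Row k) → r ∈ enum) where

  open SPBFS canon enum
  open State

  canon≡⇔∼ : ∀ {P Q} → canon P ≡ canon Q ⇔ P ∼ Q
  canon≡⇔∼ {P} {Q} = mk⇔ (≅⇒∼ ∘ Equivalence.to (canon-spec P Q)) (Equivalence.from (canon-spec P Q) ∘ ∼⇒≅)

  ∈-map-canon⇔ : ∀ {P Ls} → canon P ∈ map canon Ls ⇔ Any (P ∼_) Ls
  ∈-map-canon⇔ = mk⇔ (Any.map (Equivalence.to canon≡⇔∼) ∘ map⁻) (map⁺ ∘ Any.map (Equivalence.from canon≡⇔∼))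

  ∈-map-canon? : ∀ P Ls → Dec (canon P ∈ map canon Ls)
  ∈-map-canon? P Ls = map′ (Equivalence.from ∈-map-canon⇔) (Equivalence.to ∈-map-canon⇔) (Any.any? (P ∼?_) Ls)

  E : ℕ
  E = length enum

  length≤E : ∀ {P} → Unique P → length P ≤ E
  length≤E u = Unique-length-≤ u λ {r} _ → enum-complete r

  weight : ℕ → ℕ
  weight n = suc E ^ (E ∸ n)

  potential : List (Puzzle k) → ℕ
  potential Q = sum (map (weight ∘ length) Q)

  potential-∷ʳ : ∀ Q P → potential (Q ++ P ∷ []) ≡ potential Q + weight (length P)
  potential-∷ʳ Q P = trans (cong sum (map-++ _ Q (P ∷ [])))
    (trans (sum-++ (map (weight ∘ length) Q) _) (cong (potential Q +_) (+-identityʳ _)))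

  children-weigh-less : ∀ {n c} → c ≤ E → c ≡ 0 ⊎ suc n ≤ E → c * weight (suc n) < weight n
  children-weigh-less {n} _ (inj₁ refl) = m^n>0 (suc E) (E ∸ n)
  children-weigh-less {n} {c} c≤E (inj₂ n<E) =
    subst (c * weight (suc n) <_) (sym (cong (suc E ^_) (+-∸-assoc 1 n<E))) $
    ≤-<-trans (*-monoˡ-≤ (weight (suc n)) c≤E) (*-monoˡ-< (weight (suc n)) {{m^n≢0 (suc E) (E ∸ suc n)}} (n<1+n E))

  WellFormed : State → Set
  WellFormed st = (∃ λ Ls → seen st ≡ map canon Ls) × All Unique (queue st)

  record InnerResult (P : Puzzle k) (rs : List (Row k)) (st : State) : Set where
    field
      final      : State
      run        : Inner P rs st final
      wellFormed : WellFormed final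
      added      : ℕ
      added≤     : added ≤ length rs
      added-fits : added ≡ 0 ⊎ suc (length P) ≤ E
      potential≡ : potential (queue final) ≡ potential (queue st) + added * weight (suc (length P))
  open InnerResult

  skipRow : ∀ {P r rs st} → (∀ {st′} → Inner P rs st st′ → Inner P (r ∷ rs) st st′) →
            InnerResult P rs st → InnerResult P (r ∷ rs) st
  skipRow extend res = record
    { final = final res ; run = extend (run res) ; wellFormed = wellFormed res ; added = added res
    ; added≤ = m≤n⇒m≤1+n (added≤ res) ; added-fits = added-fits res ; potential≡ = potential≡ res }

  acceptRow : ∀ {P r rs Q I b} → Unique P → r ∉ P → SUSP (r ∷ P) → canon (r ∷ P) ∉ I →
              InnerResult P rs ⟨ Q ++ (r ∷ P) ∷ [] , canon (r ∷ P) ∷ I , length (r ∷ P) ⟩ →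
              InnerResult P (r ∷ rs) ⟨ Q , I , b ⟩
  acceptRow {P} {r} {Q = Q} uP r∉P susp unseen res = record
    { final      = final res
    ; run        = accept r∉P susp unseen (run res)
    ; wellFormed = wellFormed res
    ; added      = suc (added res)
    ; added≤     = s≤s (added≤ res)
    ; added-fits = inj₂ (length≤E (Unique-∷ r∉P uP))
    ; potential≡ = trans (potential≡ res) (trans (cong (_+ _) (potential-∷ʳ Q (r ∷ P))) (+-assoc (potential Q) _ (added res * _)))
    }

  runInner : ∀ {P} → Unique P → ∀ rs {Q I b} → WellFormed ⟨ Q , I , b ⟩ → InnerResult P rs ⟨ Q , I , b ⟩
  runInner uP [] wf = record
    { final = _ ; run = done ; wellFormed = wf ; added = 0 ; added≤ = z≤n ; added-fits = inj₁ refl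
    ; potential≡ = sym (+-identityʳ _) }
  runInner {P} uP (r ∷ rs) {Q} {I} {b} wf@((Ls , I≡) , uQ) = decide (r ∈ᴿ? P) (SUSP? (r ∷ P)) (∈-map-canon? (r ∷ P) Ls)
    where
    decide : Dec (r ∈ P) → Dec (SUSP (r ∷ P)) → Dec (canon (r ∷ P) ∈ map canon Ls) → InnerResult P (r ∷ rs) ⟨ Q , I , b ⟩
    decide (yes r∈P) _ _ = skipRow (member r∈P) (runInner uP rs wf)
    decide (no r∉P) (no ¬susp) _ = skipRow (reject r∉P (¬susp ∘ proj₁)) (runInner uP rs wf)
    decide (no r∉P) (yes _) (yes seen) =
      skipRow (reject r∉P λ (_ , unseen) → unseen (subst (canon (r ∷ P) ∈_) (sym I≡) seen)) (runInner uP rs wf)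
    decide (no r∉P) (yes susp) (no unseen) =
      acceptRow uP r∉P susp (unseen ∘ subst (canon (r ∷ P) ∈_) I≡)
        (runInner uP rs (((r ∷ P) ∷ Ls , cong (canon (r ∷ P) ∷_) I≡) , ++⁺ uQ (Unique-∷ r∉P uP ∷ [])))

  runOuter : ∀ st → WellFormed st → Acc _<_ (potential (queue st)) → ∃ (Run st)
  runOuter ⟨ [] , _ , b ⟩ _ _ = b , stop
  runOuter ⟨ P ∷ Q , I , b ⟩ (seen , uP ∷ uQ) (acc rec) =
    let res = runInner uP enum (seen , uQ)
        (result , rest) = runOuter (final res) (wellFormed res) (rec (decreases res))
    in result , step (run res) rest
    where
    decreases : (res : InnerResult P enum ⟨ Q , I , b ⟩) → potential (queue (final res)) < potential (P ∷ Q)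
    decreases res = begin-strict
      potential (queue (final res))                     ≡⟨ potential≡ res ⟩
      potential Q + added res * weight (suc (length P)) <⟨ +-monoʳ-< (potential Q) (children-weigh-less (added≤ res) (added-fits res)) ⟩
      potential Q + weight (length P)                   ≡⟨ +-comm (potential Q) _ ⟩
      potential (P ∷ Q)                                 ∎
      where open ≤-Reasoning

  terminates : ∃ Returns
  terminates = runOuter _ (([] , refl) , [] ∷ []) (<-wellFounded _)

  -- The empty puzzle is enqueued initially without its canonical form entering I.
  Found : List (Puzzle k) → List (Puzzle k)
  Found accepted = accepted ∷ʳ []

  ClosedExcept : List (Row k) → List (Puzzle k) → Puzzle k → Set
  ClosedExcept rs accepted P = ∀ r → r ∉ P → SUSP (r ∷ P) → r ∈ rs ⊎ Any ((r ∷ P) ∼_) accepted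

  Closed : List (Puzzle k) → Puzzle k → Set
  Closed accepted P = ∀ r → r ∉ P → SUSP (r ∷ P) → Any ((r ∷ P) ∼_) accepted

  ClosedExcept-skip : ∀ {r rs accepted P} → ClosedExcept (r ∷ rs) accepted P →
                    (r ∉ P → SUSP (r ∷ P) → Any ((r ∷ P) ∼_) accepted) → ClosedExcept rs accepted P
  ClosedExcept-skip closed covered r′ r′∉P susp with closed r′ r′∉P susp
  ... | inj₁ (here refl)    = inj₂ (covered r′∉P susp)
  ... | inj₁ (there r′∈rs)  = inj₁ r′∈rs
  ... | inj₂ equivalent     = inj₂ equivalent

  ClosedExcept-∷ : ∀ {rs accepted P x} → ClosedExcept rs accepted P → ClosedExcept rs (x ∷ accepted) P
  ClosedExcept-∷ closed r r∉P susp = Sum.map₂ there (closed r r∉P susp)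

  ClosedExcept-[] : ∀ {accepted P} → ClosedExcept [] accepted P → Closed accepted P
  ClosedExcept-[] closed r r∉P susp = [ (λ ()) , id ] (closed r r∉P susp)

  Closed-∷ : ∀ {accepted P x} → Closed accepted P → Closed (x ∷ accepted) P
  Closed-∷ closed r r∉P susp = there (closed r r∉P susp)

  SortedByLength : List (Puzzle k) → Set
  SortedByLength = AllPairs λ P P′ → length P ≤ length P′

  -- The queue is sorted by length and its lengths lie in {b ∸ 1, b}, which is what
  -- makes b, the size of the last accepted puzzle, the largest size found.
  record Invariant (Q : List (Puzzle k)) (I : List C) (b : ℕ) : Set where
    field
      accepted         : List (Puzzle k)
      seen≡            : I ≡ map canon accepted
      found-SUSP       : All (λ P → Unique P × SUSP P) (Found accepted)
      queued⇒found     : All (_∈ Found accepted) Q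
      queued-or-closed : All (λ P → P ∈ Q ⊎ Closed accepted P) (Found accepted)
      sorted           : SortedByLength Q
      queued≤best      : All (λ P → length P ≤ b) Q
      best≤queued+1    : All (λ P → b ≤ suc (length P)) Q
      found≤best       : All (λ P → length P ≤ b) (Found accepted)
      best-found       : Any (λ P → length P ≡ b) (Found accepted)

  record InnerInvariant (P : Puzzle k) (Q : List (Puzzle k)) (I : List C) (b : ℕ) : Set where
    field
      accepted         : List (Puzzle k)
      seen≡            : I ≡ map canon accepted
      found-SUSP       : All (λ P₀ → Unique P₀ × SUSP P₀) (Found accepted)
      queued⇒found     : All (_∈ Found accepted) Q
      queued-closed-or-current : All (λ P₀ → P₀ ∈ Q ⊎ Closed accepted P₀ ⊎ P₀ ≡ P) (Found accepted)
      sorted           : SortedByLength Q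
      queued≤best      : All (λ P₀ → length P₀ ≤ b) Q
      current≤queued   : All (λ P₀ → length P ≤ length P₀) Q
      best≤current+1   : b ≤ suc (length P)
      found≤best       : All (λ P₀ → length P₀ ≤ b) (Found accepted)
      best-found       : Any (λ P₀ → length P₀ ≡ b) (Found accepted)
      current-Unique   : Unique P

  dequeue : ∀ {P Q I b} → Invariant (P ∷ Q) I b → InnerInvariant P Q I b
  dequeue inv = record
    { accepted = accepted ; seen≡ = seen≡ ; found-SUSP = found-SUSP
    ; queued⇒found = All.tail queued⇒found
    ; queued-closed-or-current = All.map (λ where
        (inj₁ (here refl))    → inj₂ (inj₂ refl)
        (inj₁ (there queued)) → inj₁ queued
        (inj₂ closed)         → inj₂ (inj₁ closed)) queued-or-closed
    ; sorted = AllPairs.tail sorted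
    ; queued≤best = All.tail queued≤best
    ; current≤queued = AllPairs.head sorted
    ; best≤current+1 = All.head best≤queued+1
    ; found≤best = found≤best ; best-found = best-found
    ; current-Unique = proj₁ (All.lookup found-SUSP (All.head queued⇒found))
    }
    where open Invariant inv

  finish : ∀ {P Q I b} (inv : InnerInvariant P Q I b) → Closed (InnerInvariant.accepted inv) P → Invariant Q I b
  finish inv closed = record
    { accepted = accepted ; seen≡ = seen≡ ; found-SUSP = found-SUSP ; queued⇒found = queued⇒found
    ; queued-or-closed = All.map [ inj₁ , [ inj₂ , (λ { refl → inj₂ closed }) ] ] queued-closed-or-current
    ; sorted = sorted ; queued≤best = queued≤best
    ; best≤queued+1 = All.map (λ P≤P₀ → ≤-trans best≤current+1 (s≤s P≤P₀)) current≤queued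
    ; found≤best = found≤best ; best-found = best-found
    }
    where open InnerInvariant inv

  accept-invariant : ∀ {P Q I b r} → InnerInvariant P Q I b → r ∉ P → SUSP (r ∷ P) →
                     InnerInvariant P (Q ++ (r ∷ P) ∷ []) (canon (r ∷ P) ∷ I) (length (r ∷ P))
  accept-invariant {P} {Q} {r = r} inv r∉P susp = record
    { accepted = (r ∷ P) ∷ accepted
    ; seen≡ = cong (canon (r ∷ P) ∷_) seen≡
    ; found-SUSP = (Unique-∷ r∉P current-Unique , susp) ∷ found-SUSP
    ; queued⇒found = ++⁺ (All.map there queued⇒found) (here refl ∷ [])
    ; queued-closed-or-current = inj₁ (∈-++⁺ʳ Q (here refl)) ∷
        All.map (Sum.map ∈-++⁺ˡ (Sum.map₁ Closed-∷)) queued-closed-or-current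
    ; sorted = AllPairs.++⁺ sorted ([] ∷ []) (All.map (λ P₀≤b → ≤-trans P₀≤b best≤current+1 ∷ []) queued≤best)
    ; queued≤best = ++⁺ (All.map (λ P₀≤b → ≤-trans P₀≤b best≤current+1) queued≤best) (≤-refl ∷ [])
    ; current≤queued = ++⁺ current≤queued (n≤1+n _ ∷ [])
    ; best≤current+1 = ≤-refl
    ; found≤best = ≤-refl ∷ All.map (λ P₀≤b → ≤-trans P₀≤b best≤current+1) found≤best
    ; best-found = here refl
    ; current-Unique = current-Unique
    }
    where open InnerInvariant inv

  inner-invariant : ∀ {P rs Q I b st} → Inner P rs ⟨ Q , I , b ⟩ st →
                    (inv : InnerInvariant P Q I b) → ClosedExcept rs (InnerInvariant.accepted inv) P →
                    Σ (InnerInvariant P (queue st) (seen st) (best st)) λ inv′ → Closed (InnerInvariant.accepted inv′) P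
  inner-invariant done inv closed = inv , ClosedExcept-[] closed
  inner-invariant (member r∈P run) inv closed =
    inner-invariant run inv (ClosedExcept-skip closed λ r∉P _ → contradiction r∈P r∉P)
  inner-invariant (reject _ ¬new run) inv closed =
    inner-invariant run inv (ClosedExcept-skip closed λ _ susp → Equivalence.to ∈-map-canon⇔ $
      decidable-stable (∈-map-canon? _ _) λ unseen → ¬new (susp , unseen ∘ subst (_ ∈_) (InnerInvariant.seen≡ inv)))
  inner-invariant (accept r∉P susp _ run) inv closed =
    inner-invariant run (accept-invariant inv r∉P susp) (ClosedExcept-skip (ClosedExcept-∷ closed) λ _ _ → here ∼-refl)

  initial : Invariant ([] ∷ []) [] 0
  initial = record
    { accepted = [] ; seen≡ = refl ; found-SUSP = ([] , SUSP-[]) ∷ [] ; queued⇒found = here refl ∷ []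
    ; queued-or-closed = inj₁ (here refl) ∷ [] ; sorted = [] ∷ [] ; queued≤best = z≤n ∷ []
    ; best≤queued+1 = z≤n ∷ [] ; found≤best = z≤n ∷ [] ; best-found = here refl
    }

  module _ {I b} (inv : Invariant [] I b) where
    open Invariant inv

    represented : ∀ P → Unique P → SUSP P → Any (P ∼_) (Found accepted)
    represented []      _          _    = ++⁺ʳ accepted (here ∼-refl)
    represented (r ∷ P) (r∉P ∷ uP) susp with find (represented P uP (SUSP-tail r P susp))
    ... | P′ , P′∈found , P∼P′ = ++⁺ˡ (Any.map (∼-trans (∼-∷ P∼P′ r)) extension-found)
      where
      closed : Closed accepted P′
      closed = [ (λ ()) , id ] (All.lookup queued-or-closed P′∈found)
      extension-found : Any ((relabelRow P∼P′ r ∷ P′) ∼_) accepted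
      extension-found = closed _ (relabelRow-∉ P∼P′ (All¬⇒¬Any r∉P)) (SUSP-resp-∼ (∼-∷ P∼P′ r) susp)

    maximal : IsMaxSUSPSize k b
    maximal = witness , bound
      where
      witness : Σ (Puzzle k) λ P → Unique P × SUSP P × length P ≡ b
      witness with find best-found
      ... | P , P∈found , length≡b = let (uP , susp) = All.lookup found-SUSP P∈found in P , uP , susp , length≡b
      bound : ∀ P → Unique P → SUSP P → length P ≤ b
      bound P uP susp with find (represented P uP susp)
      ... | P′ , P′∈found , P∼P′ = subst (_≤ b) (sym (↔⇒≡ (_∼_.rows P∼P′))) (All.lookup found≤best P′∈found)

  correct : ∀ {st res} → Run st res → Invariant (queue st) (seen st) (best st) → IsMaxSUSPSize k res
  correct stop inv = maximal inv
  correct (step inner run) inv with inner-invariant inner (dequeue inv) (λ r _ _ → inj₁ (enum-complete r))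
  ... | inv′ , closed = correct run (finish inv′ closed)

lemma9 : (k : ℕ) {C : Set} (canon : Puzzle k → C)
         → (∀ (P Q : Puzzle k) → (canon P ≡ canon Q) ⇔ (G P ≅ G Q))
         → (enum : List (Row k)) → Unique enum → (∀ (r : Row k) → r ∈ enum)
         → (∃ λ b → SPBFS.Returns canon enum b)
         × (∀ b → SPBFS.Returns canon enum b → IsMaxSUSPSize k b)
-- enum need not be duplicate-free: a repeated row is rejected, its extension being seen.
lemma9 k canon canon-spec enum _ enum-complete = terminates , λ _ returns → correct returns initial
  where open BFS k canon canon-spec enum enum-complete
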